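{- Let $n = p_1^{k_1} p_2^{k_2} \cdots p_r^{k_r}$ be the prime factorization of a positive integer $n$, with distinct primes $p_i$ and integers $k_i \ge 1$. Then the number of edges of the divisor prime graph $G_{Dp(n)}$ is $$|E(G_{Dp(n)})| = \frac{1}{2}\left( \prod_{i=1}^r (2k_i + 1) - 1 \right).$$
   Context: For a positive integer $n$, the divisor prime graph $G_{Dp(n)}$ is the simple graph whose vertex set is the set of positive divisors of $n$, in which two distinct vertices $x, y$ are adjacent if and only if $\gcd(x,y) = 1$ (no loops are included, in particular no loop at the vertex $1$). -}

module Defs where

open import Data.Nat using (ℕ; suc; _+_; _*_; _^_; _<_; _∸_)
open import Data.Nat.Base using (_<ᵇ_)
open import Data.Nat.Divisibility using (_∣_; _∣?_)
open import Data.Nat.GCD using (gcd)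
open import Data.Nat.Properties using (_≟_; _<?_)
open import Data.List using (List; []; _∷_; filter; upTo; map; length; cartesianProduct)
open import Data.Nat.ListAction using (product)
open import Data.Product using (_×_; _,_; proj₁; proj₂)
open import Relation.Nullary.Decidable using (_×-dec_)
open import Relation.Binary.PropositionalEquality using (_≡_)

divisors : ℕ → List ℕ
divisors n = filter (λ d → d ∣? n) (map suc (upTo n))

-- Edges of the divisor prime graph G_Dp(n): unordered pairs {x , y} of
-- distinct divisors, represented once as ordered pairs with x < y,
-- such that gcd x y ≡ 1.
dpEdges : ℕ → List (ℕ × ℕ)
dpEdges n =
  filter (λ e → (proj₁ e <? proj₂ e) ×-dec (gcd (proj₁ e) (proj₂ e) ≟ 1))
         (cartesianProduct (divisors n) (divisors n))

edgeCount : ℕ → ℕ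
edgeCount n = length (dpEdges n)

factorValue : List (ℕ × ℕ) → ℕ
factorValue fs = product (map (λ pk → proj₁ pk ^ proj₂ pk) fs)

oddProduct : List (ℕ × ℕ) → ℕ
oddProduct fs = product (map (λ pk → 2 * proj₂ pk + 1) fs)

{-# OPTIONS --safe #-}
-- Instead of edges, count the ordered pairs (x , y) of coprime divisors of n: they are the
-- edges in both orientations together with the single loop (1 , 1), so there are 2|E| + 1
-- of them. This count is multiplicative. If p ∤ m, every divisor of p^k m is uniquely p^i d
-- with i ≤ k and d ∣ m, and p^i d, p^j e are coprime iff d, e are coprime and i = 0 or j = 0;
-- there are 2k + 1 such exponent pairs (i , j), whence the product of the 2 k_i + 1.
module Submission where

open import Defs
open import Data.Nat using (ℕ; zero; suc; _+_; _*_; _∸_; _^_; _≤_; _<_; z≤n; s≤s; NonZero; ≢-nonZero⁻¹; nonTrivial⇒≢1)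
open import Data.Nat.Properties
  using (_≟_; _<?_; suc-injective; +-comm; +-identityʳ; *-comm; *-assoc; *-identityˡ; *-cancelˡ-≡;
         m*n≢0; m^n≢0; ≤-pred; <-cmp; <-irrefl; <-asym)
open import Data.Nat.Divisibility using (_∣_; _∣?_; divides; ∣⇒≤; 0∣⇒≡0; ∣-refl; 1∣_; ∣-trans; ∣1⇒≡1; n∣m*n; m∣m*n; *-pres-∣; *-monoʳ-∣; *-cancelˡ-∣)
open import Data.Nat.GCD using (gcd)
open import Data.Nat.Coprimality as Coprime using (Coprime; gcd≡1⇒coprime; coprime⇒gcd≡1; coprime-divisor)
open import Data.Nat.Primality using (Prime; prime⇒irreducible; prime⇒nonZero; prime⇒nonTrivial; euclidsLemma)
open import Data.List using (List; []; _∷_; _++_; map; filter; upTo; length; cartesianProduct)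
open import Data.List.Properties using (length-++; length-map; length-upTo)
open import Data.List.Membership.Propositional using (_∈_)
open import Data.List.Membership.Propositional.Properties
  using (∈-filter⁺; ∈-filter⁻; ∈-map⁺; ∈-map⁻; ∈-upTo⁺; ∈-upTo⁻; ∈-++⁺ˡ; ∈-++⁺ʳ; ∈-++⁻;
         ∈-cartesianProduct⁺; ∈-cartesianProduct⁻)
open import Data.List.Membership.Propositional.Properties.WithK using (unique∧set⇒bag)
open import Data.List.Relation.Binary.BagAndSetEquality using (_∼[_]_; set; ∼bag⇒↭)
open import Data.List.Relation.Binary.Permutation.Propositional.Properties using (↭-length)
open import Data.List.Relation.Unary.Any using (here; there)
open import Data.List.Relation.Unary.All as All using (All; []; _∷_)
import Data.List.Relation.Unary.All.Properties as All
open import Data.List.Relation.Unary.AllPairs using ([]; _∷_)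
open import Data.List.Relation.Unary.Unique.Propositional using (Unique)
import Data.List.Relation.Unary.Unique.Propositional.Properties as Unique
open import Data.Product using (_×_; _,_; proj₁; proj₂; swap; ∃-syntax)
open import Data.Sum using (_⊎_; inj₁; inj₂)
open import Data.Empty using (⊥-elim)
open import Function.Base using (_∘_)
open import Function.Bundles using (mk⇔)
open import Relation.Nullary using (¬_; yes; no)
open import Relation.Nullary.Decidable using (_×-dec_)
open import Relation.Binary.Definitions using (tri<; tri≈; tri>)
open import Relation.Binary.PropositionalEquality

unique∧set⇒length≡ : ∀ {a} {A : Set a} {xs ys : List A} →
  Unique xs → Unique ys → xs ∼[ set ] ys → length xs ≡ length ys
unique∧set⇒length≡ xs! ys! xs≈ys = ↭-length (∼bag⇒↭ (unique∧set⇒bag xs! ys! xs≈ys))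

map⁺-injectiveOn : ∀ {A B : Set} {f : A → B} {xs : List A} →
  (∀ {x y} → x ∈ xs → y ∈ xs → f x ≡ f y → x ≡ y) → Unique xs → Unique (map f xs)
map⁺-injectiveOn _ [] = []
map⁺-injectiveOn inj (x∉xs ∷ xs!) =
  All.map⁺ (All.tabulate λ y∈xs fx≡fy → All.lookup x∉xs y∈xs (inj (here refl) (there y∈xs) fx≡fy))
  ∷ map⁺-injectiveOn (λ x∈ y∈ → inj (there x∈) (there y∈)) xs!

length-cartesianProduct : ∀ {A B : Set} (xs : List A) (ys : List B) →
  length (cartesianProduct xs ys) ≡ length xs * length ys
length-cartesianProduct []       ys = refl
length-cartesianProduct (x ∷ xs) ys = begin
  length (map (x ,_) ys ++ cartesianProduct xs ys)        ≡⟨ length-++ (map (x ,_) ys) ⟩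
  length (map (x ,_) ys) + length (cartesianProduct xs ys) ≡⟨ cong₂ _+_ (length-map (x ,_) ys) (length-cartesianProduct xs ys) ⟩
  length ys + length xs * length ys                       ∎
  where open ≡-Reasoning

divisors-unique : ∀ n → Unique (divisors n)
divisors-unique n = Unique.filter⁺ (_∣? n) (Unique.map⁺ suc-injective (Unique.upTo⁺ n))

∈-divisors⁻ : ∀ {n d} → d ∈ divisors n → d ∣ n
∈-divisors⁻ {n} d∈ = proj₂ (∈-filter⁻ (_∣? n) {xs = map suc (upTo n)} d∈)

∈-divisors⁺ : ∀ {n d} .{{_ : NonZero n}} → d ∣ n → d ∈ divisors n
∈-divisors⁺ {n} {zero}  0∣n with () ← ≢-nonZero⁻¹ n (0∣⇒≡0 0∣n)
∈-divisors⁺ {n} {suc d} d∣n = ∈-filter⁺ (_∣? n) (∈-map⁺ suc (∈-upTo⁺ (∣⇒≤ d∣n))) d∣n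

coprimePairs : ℕ → List (ℕ × ℕ)
coprimePairs n = filter (λ (x , y) → gcd x y ≟ 1) (cartesianProduct (divisors n) (divisors n))

coprimePairs-unique : ∀ n → Unique (coprimePairs n)
coprimePairs-unique n = Unique.filter⁺ _ (Unique.cartesianProduct⁺ (divisors-unique n) (divisors-unique n))

∈-coprimePairs⁻ : ∀ {n x y} → (x , y) ∈ coprimePairs n → x ∣ n × y ∣ n × Coprime x y
∈-coprimePairs⁻ {n} xy∈ with xy∈pairs , gcd≡1 ← ∈-filter⁻ _ xy∈
  with x∈ , y∈ ← ∈-cartesianProduct⁻ (divisors n) (divisors n) xy∈pairs
  = ∈-divisors⁻ x∈ , ∈-divisors⁻ y∈ , gcd≡1⇒coprime gcd≡1

∈-coprimePairs⁺ : ∀ {n x y} .{{_ : NonZero n}} → x ∣ n → y ∣ n → Coprime x y → (x , y) ∈ coprimePairs n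
∈-coprimePairs⁺ x∣n y∣n x⊥y =
  ∈-filter⁺ _ (∈-cartesianProduct⁺ (∈-divisors⁺ x∣n) (∈-divisors⁺ y∣n)) (coprime⇒gcd≡1 x⊥y)

dpEdges-unique : ∀ n → Unique (dpEdges n)
dpEdges-unique n = Unique.filter⁺ _ (Unique.cartesianProduct⁺ (divisors-unique n) (divisors-unique n))

∈-dpEdges⁻ : ∀ {n x y} → (x , y) ∈ dpEdges n → x ∣ n × y ∣ n × x < y × Coprime x y
∈-dpEdges⁻ {n} xy∈
  with xy∈pairs , (x<y , gcd≡1) ← ∈-filter⁻ (λ e → (proj₁ e <? proj₂ e) ×-dec (gcd (proj₁ e) (proj₂ e) ≟ 1)) xy∈
  with x∈ , y∈ ← ∈-cartesianProduct⁻ (divisors n) (divisors n) xy∈pairs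
  = ∈-divisors⁻ x∈ , ∈-divisors⁻ y∈ , x<y , gcd≡1⇒coprime gcd≡1

∈-dpEdges⁺ : ∀ {n x y} .{{_ : NonZero n}} → x ∣ n → y ∣ n → x < y → Coprime x y → (x , y) ∈ dpEdges n
∈-dpEdges⁺ x∣n y∣n x<y x⊥y =
  ∈-filter⁺ _ (∈-cartesianProduct⁺ (∈-divisors⁺ x∣n) (∈-divisors⁺ y∣n)) (x<y , coprime⇒gcd≡1 x⊥y)

edgesBothWays : ℕ → List (ℕ × ℕ)
edgesBothWays n = (1 , 1) ∷ dpEdges n ++ map swap (dpEdges n)

edgesBothWays-unique : ∀ n → Unique (edgesBothWays n)
edgesBothWays-unique n =
  All.tabulate loop∉ ∷ Unique.++⁺ (dpEdges-unique n) (Unique.map⁺ swap-injective (dpEdges-unique n)) disjoint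
  where
  swap-injective : ∀ {u v : ℕ × ℕ} → swap u ≡ swap v → u ≡ v
  swap-injective refl = refl

  ordered : ∀ {x y} → (x , y) ∈ dpEdges n → x < y
  ordered xy∈ with _ , _ , x<y , _ ← ∈-dpEdges⁻ {n} xy∈ = x<y

  loop∉ : ∀ {v} → v ∈ dpEdges n ++ map swap (dpEdges n) → (1 , 1) ≢ v
  loop∉ v∈ refl with ∈-++⁻ (dpEdges n) v∈
  ... | inj₁ 11∈ = <-irrefl refl (ordered 11∈)
  ... | inj₂ 11∈ with (1 , 1) , 11∈′ , refl ← ∈-map⁻ swap 11∈ = <-irrefl refl (ordered 11∈′)

  disjoint : ∀ {v} → ¬ (v ∈ dpEdges n × v ∈ map swap (dpEdges n))
  disjoint (v∈ , v∈swapped) with (_ , _) , v′∈ , refl ← ∈-map⁻ swap v∈swapped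
    = <-asym (ordered v∈) (ordered v′∈)

coprimePairs≈edgesBothWays : ∀ n .{{_ : NonZero n}} → coprimePairs n ∼[ set ] edgesBothWays n
coprimePairs≈edgesBothWays n = mk⇔ to from
  where
  to : ∀ {v} → v ∈ coprimePairs n → v ∈ edgesBothWays n
  to {x , y} xy∈ with x∣n , y∣n , x⊥y ← ∈-coprimePairs⁻ xy∈ | <-cmp x y
  ... | tri< x<y _ _ = there (∈-++⁺ˡ (∈-dpEdges⁺ x∣n y∣n x<y x⊥y))
  ... | tri> _ _ y<x = there (∈-++⁺ʳ (dpEdges n) (∈-map⁺ swap (∈-dpEdges⁺ y∣n x∣n y<x (Coprime.sym x⊥y))))
  ... | tri≈ _ refl _ with refl ← x⊥y (∣-refl , ∣-refl) = here refl

  from : ∀ {v} → v ∈ edgesBothWays n → v ∈ coprimePairs n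
  from (here refl) = ∈-coprimePairs⁺ (1∣ n) (1∣ n) (λ (c∣1 , _) → ∣1⇒≡1 c∣1)
  from (there v∈) with ∈-++⁻ (dpEdges n) v∈
  ... | inj₁ xy∈ with x∣n , y∣n , _ , x⊥y ← ∈-dpEdges⁻ {n} xy∈ = ∈-coprimePairs⁺ x∣n y∣n x⊥y
  ... | inj₂ yx∈ with (_ , _) , xy∈ , refl ← ∈-map⁻ swap yx∈
    with x∣n , y∣n , _ , x⊥y ← ∈-dpEdges⁻ {n} xy∈ = ∈-coprimePairs⁺ y∣n x∣n (Coprime.sym x⊥y)

length-coprimePairs : ∀ n .{{_ : NonZero n}} → length (coprimePairs n) ≡ suc (2 * edgeCount n)
length-coprimePairs n = begin
  length (coprimePairs n)
    ≡⟨ unique∧set⇒length≡ (coprimePairs-unique n) (edgesBothWays-unique n) (coprimePairs≈edgesBothWays n) ⟩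
  suc (length (dpEdges n ++ map swap (dpEdges n)))
    ≡⟨ cong suc (length-++ (dpEdges n)) ⟩
  suc (e + length (map swap (dpEdges n)))
    ≡⟨ cong (λ l → suc (e + l)) (trans (length-map swap (dpEdges n)) (sym (+-identityʳ e))) ⟩
  suc (2 * e) ∎
  where
  open ≡-Reasoning
  e = edgeCount n

∣∧coprime⇒coprime : ∀ {c d x} → c ∣ d → Coprime d x → Coprime c x
∣∧coprime⇒coprime c∣d d⊥x (a∣c , a∣x) = d⊥x (∣-trans a∣c c∣d , a∣x)

coprime-* : ∀ {d x y} → Coprime d x → Coprime d y → Coprime d (x * y)
coprime-* d⊥x d⊥y (c∣d , c∣xy) = d⊥y (c∣d , coprime-divisor (∣∧coprime⇒coprime c∣d d⊥x) c∣xy)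

coprime-^ : ∀ {d x} j → Coprime d x → Coprime d (x ^ j)
coprime-^ zero    _   (_ , c∣1) = ∣1⇒≡1 c∣1
coprime-^ (suc j) d⊥x = coprime-* d⊥x (coprime-^ j d⊥x)

^-monoʳ-∣ : ∀ x {i k} → i ≤ k → x ^ i ∣ x ^ k
^-monoʳ-∣ x {k = k} z≤n = 1∣ (x ^ k)
^-monoʳ-∣ x (s≤s i≤k)   = *-monoʳ-∣ x (^-monoʳ-∣ x i≤k)

m∣m^[1+i]*n : ∀ m i n → m ∣ m ^ suc i * n
m∣m^[1+i]*n m i n = subst (m ∣_) (sym (*-assoc m (m ^ i) n)) (m∣m*n (m ^ i * n))

module _ {p : ℕ} (p-prime : Prime p) where

  private instance
    p≢0 : NonZero p
    p≢0 = prime⇒nonZero p-prime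

  p≢1 : p ≢ 1
  p≢1 = nonTrivial⇒≢1 {{prime⇒nonTrivial p-prime}}

  ∤⇒coprime : ∀ {d} → ¬ p ∣ d → Coprime d p
  ∤⇒coprime p∤d (c∣d , c∣p) with prime⇒irreducible p-prime c∣p
  ... | inj₁ c≡1  = c≡1
  ... | inj₂ refl = ⊥-elim (p∤d c∣d)

  divisor-p^k*m : ∀ {m} → ¬ p ∣ m → ∀ k {x} → x ∣ p ^ k * m →
    ∃[ i ] ∃[ d ] i ≤ k × d ∣ m × x ≡ p ^ i * d
  divisor-p^k*m {m} p∤m zero {x} x∣ = 0 , x , z≤n , subst (x ∣_) (*-identityˡ m) x∣ , sym (*-identityˡ x)
  divisor-p^k*m {m} p∤m (suc k) {x} x∣ with p ∣? x
  ... | no p∤x = 0 , x , z≤n , coprime-divisor (coprime-^ (suc k) (∤⇒coprime p∤x)) x∣ , sym (*-identityˡ x)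
  ... | yes (divides q refl) with divisor-p^k*m p∤m k (*-cancelˡ-∣ p p*q∣p*[p^k*m])
    where
    p*q∣p*[p^k*m] : p * q ∣ p * (p ^ k * m)
    p*q∣p*[p^k*m] = subst₂ _∣_ (*-comm q p) (*-assoc p (p ^ k) m) x∣
  ...   | i , d , i≤k , d∣m , refl = suc i , d , s≤s i≤k , d∣m , trans (*-comm (p ^ i * d) p) (sym (*-assoc p (p ^ i) d))

  p^i*d-injective : ∀ i i′ {d d′} → ¬ p ∣ d → ¬ p ∣ d′ → p ^ i * d ≡ p ^ i′ * d′ → i ≡ i′ × d ≡ d′
  p^i*d-injective zero    zero     {d} {d′} _   _    eq =
    refl , trans (sym (*-identityˡ d)) (trans eq (*-identityˡ d′))
  p^i*d-injective (suc i) zero     {d} {d′} _   p∤d′ eq =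
    ⊥-elim (p∤d′ (subst (p ∣_) (trans eq (*-identityˡ d′)) (m∣m^[1+i]*n p i d)))
  p^i*d-injective zero    (suc i′) {d} {d′} p∤d _    eq =
    ⊥-elim (p∤d (subst (p ∣_) (trans (sym eq) (*-identityˡ d)) (m∣m^[1+i]*n p i′ d′)))
  p^i*d-injective (suc i) (suc i′) {d} {d′} p∤d p∤d′ eq
    with refl , refl ← p^i*d-injective i i′ p∤d p∤d′ (*-cancelˡ-≡ (p ^ i * d) (p ^ i′ * d′) p
                         (trans (sym (*-assoc p (p ^ i) d)) (trans eq (*-assoc p (p ^ i′) d′))))
    = refl , refl

  coprime-p^i*d⁻ : ∀ i j {d e} → Coprime (p ^ i * d) (p ^ j * e) → (i ≡ 0 ⊎ j ≡ 0) × Coprime d e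
  coprime-p^i*d⁻ i j {d} {e} cop =
    some-exponent-vanishes i j cop , λ (c∣d , c∣e) → cop (∣-trans c∣d (n∣m*n (p ^ i)) , ∣-trans c∣e (n∣m*n (p ^ j)))
    where
    some-exponent-vanishes : ∀ i j → Coprime (p ^ i * d) (p ^ j * e) → i ≡ 0 ⊎ j ≡ 0
    some-exponent-vanishes zero    _       _   = inj₁ refl
    some-exponent-vanishes (suc i) zero    _   = inj₂ refl
    some-exponent-vanishes (suc i) (suc j) cop = ⊥-elim (p≢1 (cop (m∣m^[1+i]*n p i d , m∣m^[1+i]*n p j e)))

  coprime-p^i*d⁺ : ∀ i j {d e} → ¬ p ∣ d → ¬ p ∣ e → i ≡ 0 ⊎ j ≡ 0 → Coprime d e → Coprime (p ^ i * d) (p ^ j * e)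
  coprime-p^i*d⁺ i j {d} {e} p∤d _ (inj₁ refl) d⊥e =
    subst (λ x → Coprime x (p ^ j * e)) (sym (*-identityˡ d)) (coprime-* (coprime-^ j (∤⇒coprime p∤d)) d⊥e)
  coprime-p^i*d⁺ i j {d} {e} _ p∤e (inj₂ refl) d⊥e =
    subst (Coprime (p ^ i * d)) (sym (*-identityˡ e)) (Coprime.sym (coprime-* (coprime-^ i (∤⇒coprime p∤e)) (Coprime.sym d⊥e)))

verticalAxis horizontalAxis axisPoints : ℕ → List (ℕ × ℕ)
verticalAxis   k = map (0 ,_) (upTo (suc k))
horizontalAxis k = map (λ i → (suc i , 0)) (upTo k)
axisPoints     k = verticalAxis k ++ horizontalAxis k

length-axisPoints : ∀ k → length (axisPoints k) ≡ 2 * k + 1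
length-axisPoints k = begin
  length (verticalAxis k ++ horizontalAxis k)         ≡⟨ length-++ (verticalAxis k) ⟩
  length (verticalAxis k) + length (horizontalAxis k) ≡⟨ cong₂ _+_ (trans (length-map _ (upTo (suc k))) (length-upTo (suc k)))
                                                                    (trans (length-map _ (upTo k)) (length-upTo k)) ⟩
  suc k + k                                           ≡⟨ cong (λ l → suc (k + l)) (sym (+-identityʳ k)) ⟩
  suc (2 * k)                                         ≡⟨ +-comm 1 (2 * k) ⟩
  2 * k + 1                                           ∎
  where open ≡-Reasoning

axisPoints-unique : ∀ k → Unique (axisPoints k)
axisPoints-unique k =
  Unique.++⁺ (Unique.map⁺ (cong proj₂) (Unique.upTo⁺ (suc k)))
             (Unique.map⁺ (suc-injective ∘ cong proj₁) (Unique.upTo⁺ k))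
             disjoint
  where
  disjoint : ∀ {v} → ¬ (v ∈ verticalAxis k × v ∈ horizontalAxis k)
  disjoint (v∈ , v∈′) with _ , _ , refl ← ∈-map⁻ (0 ,_) v∈ | _ , _ , () ← ∈-map⁻ (λ i → (suc i , 0)) v∈′

∈-axisPoints⁻ : ∀ {k i j} → (i , j) ∈ axisPoints k → i ≤ k × j ≤ k × (i ≡ 0 ⊎ j ≡ 0)
∈-axisPoints⁻ {k} ij∈ with ∈-++⁻ (verticalAxis k) ij∈
... | inj₁ ij∈ˡ with _ , j∈ , refl ← ∈-map⁻ (0 ,_) ij∈ˡ = z≤n , ≤-pred (∈-upTo⁻ j∈) , inj₁ refl
... | inj₂ ij∈ʳ with _ , i∈ , refl ← ∈-map⁻ (λ i → (suc i , 0)) ij∈ʳ = ∈-upTo⁻ i∈ , z≤n , inj₂ refl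

∈-axisPoints⁺ : ∀ {k} i j → i ≤ k → j ≤ k → i ≡ 0 ⊎ j ≡ 0 → (i , j) ∈ axisPoints k
∈-axisPoints⁺     zero    j       _   j≤k _ = ∈-++⁺ˡ (∈-map⁺ (0 ,_) (∈-upTo⁺ (s≤s j≤k)))
∈-axisPoints⁺ {k} (suc i) zero    i<k _   _ = ∈-++⁺ʳ (verticalAxis k) (∈-map⁺ (λ i → (suc i , 0)) (∈-upTo⁺ i<k))
∈-axisPoints⁺     (suc i) (suc j) _   _   (inj₁ ())
∈-axisPoints⁺     (suc i) (suc j) _   _   (inj₂ ())

module _ {p m : ℕ} (p-prime : Prime p) (p∤m : ¬ p ∣ m) .{{_ : NonZero m}} (k : ℕ) where

  private instance
    p^k*m≢0 : NonZero (p ^ k * m)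
    p^k*m≢0 = m*n≢0 (p ^ k) m {{m^n≢0 p k {{prime⇒nonZero p-prime}}}}

  private
    exponentsAndPairs : List ((ℕ × ℕ) × (ℕ × ℕ))
    exponentsAndPairs = cartesianProduct (axisPoints k) (coprimePairs m)

    scale : (ℕ × ℕ) × (ℕ × ℕ) → ℕ × ℕ
    scale ((i , j) , (d , e)) = (p ^ i * d , p ^ j * e)

    scaledPairs : List (ℕ × ℕ)
    scaledPairs = map scale exponentsAndPairs

    p∤divisor : ∀ {d} → d ∣ m → ¬ p ∣ d
    p∤divisor d∣m p∣d = p∤m (∣-trans p∣d d∣m)

    ∈-exponentsAndPairs⁻ : ∀ {i j d e} → ((i , j) , (d , e)) ∈ exponentsAndPairs →
      (i ≤ k × j ≤ k × (i ≡ 0 ⊎ j ≡ 0)) × (d ∣ m × e ∣ m × Coprime d e)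
    ∈-exponentsAndPairs⁻ ∈L with ij∈ , de∈ ← ∈-cartesianProduct⁻ (axisPoints k) (coprimePairs m) ∈L =
      ∈-axisPoints⁻ ij∈ , ∈-coprimePairs⁻ de∈

    scaledPairs-unique : Unique scaledPairs
    scaledPairs-unique =
      map⁺-injectiveOn scale-injective (Unique.cartesianProduct⁺ (axisPoints-unique k) (coprimePairs-unique m))
      where
      scale-injective : ∀ {u v} → u ∈ exponentsAndPairs → v ∈ exponentsAndPairs → scale u ≡ scale v → u ≡ v
      scale-injective {(i , j) , (d , e)} {(i′ , j′) , (d′ , e′)} u∈ v∈ eq
        with _ , d∣m , e∣m , _ ← ∈-exponentsAndPairs⁻ u∈ | _ , d′∣m , e′∣m , _ ← ∈-exponentsAndPairs⁻ v∈
        with refl , refl ← p^i*d-injective p-prime i i′ (p∤divisor d∣m) (p∤divisor d′∣m) (cong proj₁ eq)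
           | refl , refl ← p^i*d-injective p-prime j j′ (p∤divisor e∣m) (p∤divisor e′∣m) (cong proj₂ eq)
        = refl

    coprimePairs≈scaledPairs : coprimePairs (p ^ k * m) ∼[ set ] scaledPairs
    coprimePairs≈scaledPairs = mk⇔ to from
      where
      to : ∀ {v} → v ∈ coprimePairs (p ^ k * m) → v ∈ scaledPairs
      to {x , y} xy∈ with x∣p^k*m , y∣p^k*m , x⊥y ← ∈-coprimePairs⁻ xy∈
        with i , d , i≤k , d∣m , refl ← divisor-p^k*m p-prime p∤m k x∣p^k*m
           | j , e , j≤k , e∣m , refl ← divisor-p^k*m p-prime p∤m k y∣p^k*m
        with i∨j≡0 , d⊥e ← coprime-p^i*d⁻ p-prime i j x⊥y
        = ∈-map⁺ scale (∈-cartesianProduct⁺ (∈-axisPoints⁺ i j i≤k j≤k i∨j≡0) (∈-coprimePairs⁺ d∣m e∣m d⊥e))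

      from : ∀ {v} → v ∈ scaledPairs → v ∈ coprimePairs (p ^ k * m)
      from v∈ with ((i , j) , (d , e)) , ∈L , refl ← ∈-map⁻ scale v∈
        with (i≤k , j≤k , i∨j≡0) , (d∣m , e∣m , d⊥e) ← ∈-exponentsAndPairs⁻ ∈L
        = ∈-coprimePairs⁺ (*-pres-∣ (^-monoʳ-∣ p i≤k) d∣m) (*-pres-∣ (^-monoʳ-∣ p j≤k) e∣m)
                          (coprime-p^i*d⁺ p-prime i j (p∤divisor d∣m) (p∤divisor e∣m) i∨j≡0 d⊥e)

  length-coprimePairs-p^k*m : length (coprimePairs (p ^ k * m)) ≡ (2 * k + 1) * length (coprimePairs m)
  length-coprimePairs-p^k*m = begin
    length (coprimePairs (p ^ k * m))
      ≡⟨ unique∧set⇒length≡ (coprimePairs-unique (p ^ k * m)) scaledPairs-unique coprimePairs≈scaledPairs ⟩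
    length (map scale exponentsAndPairs)
      ≡⟨ length-map scale exponentsAndPairs ⟩
    length exponentsAndPairs
      ≡⟨ length-cartesianProduct (axisPoints k) (coprimePairs m) ⟩
    length (axisPoints k) * length (coprimePairs m)
      ≡⟨ cong (_* length (coprimePairs m)) (length-axisPoints k) ⟩
    (2 * k + 1) * length (coprimePairs m) ∎
    where open ≡-Reasoning

factorValue-nonZero : ∀ fs → All (λ pk → Prime (proj₁ pk)) fs → NonZero (factorValue fs)
factorValue-nonZero []             []                = _
factorValue-nonZero ((p , k) ∷ fs) (p-prime ∷ primes) =
  m*n≢0 (p ^ k) (factorValue fs) {{m^n≢0 p k {{prime⇒nonZero p-prime}}}} {{factorValue-nonZero fs primes}}

prime∣prime^⇒≡ : ∀ {p q} → Prime p → Prime q → ∀ j → p ∣ q ^ j → p ≡ q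
prime∣prime^⇒≡ p-prime _       zero    p∣1 = ⊥-elim (p≢1 p-prime (∣1⇒≡1 p∣1))
prime∣prime^⇒≡ p-prime q-prime (suc j) p∣q^j+1 with euclidsLemma _ _ p-prime p∣q^j+1
... | inj₂ p∣q^j = prime∣prime^⇒≡ p-prime q-prime j p∣q^j
... | inj₁ p∣q with prime⇒irreducible q-prime p∣q
...   | inj₁ p≡1 = ⊥-elim (p≢1 p-prime p≡1)
...   | inj₂ p≡q = p≡q

prime∤factorValue : ∀ {p} → Prime p → ∀ fs → All (λ pk → Prime (proj₁ pk)) fs →
  All (p ≢_) (map proj₁ fs) → ¬ p ∣ factorValue fs
prime∤factorValue p-prime []             []                 []           p∣1 = p≢1 p-prime (∣1⇒≡1 p∣1)
prime∤factorValue p-prime ((q , j) ∷ fs) (q-prime ∷ primes) (p≢q ∷ p∉) p∣qʲ*n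
  with euclidsLemma (q ^ j) (factorValue fs) p-prime p∣qʲ*n
... | inj₁ p∣qʲ = p≢q (prime∣prime^⇒≡ p-prime q-prime j p∣qʲ)
... | inj₂ p∣n  = prime∤factorValue p-prime fs primes p∉ p∣n

length-coprimePairs-factorValue : ∀ fs → All (λ pk → Prime (proj₁ pk)) fs → Unique (map proj₁ fs) →
  length (coprimePairs (factorValue fs)) ≡ oddProduct fs
length-coprimePairs-factorValue []             _                  _             = refl
length-coprimePairs-factorValue ((p , k) ∷ fs) (p-prime ∷ primes) (p∉ ∷ distinct) =
  trans (length-coprimePairs-p^k*m p-prime (prime∤factorValue p-prime fs primes p∉) {{factorValue-nonZero fs primes}} k)
        (cong ((2 * k + 1) *_) (length-coprimePairs-factorValue fs primes distinct))

-- The exponents need not be positive: a factor p ^ 0 contributes 2 * 0 + 1 = 1.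
mainTheorem1 : (n : ℕ) (fs : List (ℕ × ℕ)) →
    All (λ pk → Prime (proj₁ pk)) fs →
    Unique (map proj₁ fs) →
    All (λ pk → 1 ≤ proj₂ pk) fs →
    n ≡ factorValue fs →
    2 * edgeCount n ≡ oddProduct fs ∸ 1
mainTheorem1 n fs primes distinct _ refl = begin
  2 * edgeCount n                ≡⟨⟩
  suc (2 * edgeCount n) ∸ 1      ≡⟨ cong (_∸ 1) (sym (length-coprimePairs n)) ⟩
  length (coprimePairs n) ∸ 1    ≡⟨ cong (_∸ 1) (length-coprimePairs-factorValue fs primes distinct) ⟩
  oddProduct fs ∸ 1              ∎
  where
  open ≡-Reasoning
  instance
    n≢0 : NonZero n
    n≢0 = factorValue-nonZero fs primes
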